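{- There is a bijection $f$ between domino shave positions and clockwise hackenbush positions such that $D-f(D)=0$ for every domino shave position $D$ (i.e. $D$ and $f(D)$ are equal as games).
   Context: A domino is an ordered pair $(l,r)$ of non-negative integers; it is blue if $l<r$, red if $l>r$, green if $l=r$. A domino shave position is a finite sequence $d_1,\ldots,d_k$ of dominoes $d_i=(l_i,r_i)$. Left may remove a blue or green $d_i$ together with all $d_j$, $j>i$ (leaving $d_1,\ldots,d_{i-1}$), provided $l_i\le l_j$ and $l_i\le r_j$ for all $j\ge i$; Right may do the same with a red or green $d_i$ provided $r_i\le l_j$ and $r_i\le r_j$ for all $j\ge i$. A clockwise hackenbush position is a finite tree rooted at a ground vertex and embedded in the plane (child edges at each vertex ordered left to right), each edge coloured blue, red or green; its trunk is the path from the ground obtained by repeatedly following the rightmost edge to a child until a leaf. Left may remove a blue or green trunk edge, Right a red or green trunk edge; afterwards every edge disconnected from the ground is removed and the trunk is recomputed. Both games use normal play; $G=H$ means $G-H$ is a second-player win. -}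

module Defs where

open import Data.Nat using (ℕ; _≤_)
open import Data.Product using (_×_; _,_; Σ; ∃; ∃-syntax)
open import Data.Sum using (_⊎_)
open import Data.List using (List; []; _∷_; _++_; [_])
open import Data.List.Relation.Unary.All using (All)
open import Relation.Binary.PropositionalEquality using (_≡_)
open import Level using (Level; suc; _⊔_)

record GameForm : Set₁ where
  field
    Pos : Set
    LeftMove  : Pos → Pos → Set   -- LeftMove p q : q is a Left option of p
    RightMove : Pos → Pos → Set   -- RightMove p q : q is a Right option of p

open GameForm public

neg : GameForm → GameForm
neg G = record { Pos = Pos G ; LeftMove = RightMove G ; RightMove = LeftMove G }

_⊕_ : GameForm → GameForm → GameForm
G ⊕ H = record
  { Pos = Pos G × Pos H
  ; LeftMove  = λ { (a , b) (a' , b') →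
        (LeftMove G a a' × b ≡ b') ⊎ (a ≡ a' × LeftMove H b b') }
  ; RightMove = λ { (a , b) (a' , b') →
        (RightMove G a a' × b ≡ b') ⊎ (a ≡ a' × RightMove H b b') }
  }

_⊖_ : GameForm → GameForm → GameForm
G ⊖ H = G ⊕ neg H

-- Winning strategies (inductive, i.e. finite play), normal play convention:
-- a player unable to move loses.
module Outcomes (G : GameForm) where
  mutual
    data LeftWinsSecond (p : Pos G) : Set where
      lws : (∀ q → RightMove G p q → LeftWinsFirst q) → LeftWinsSecond p

    data LeftWinsFirst (p : Pos G) : Set where
      lwf : ∀ q → LeftMove G p q → LeftWinsSecond q → LeftWinsFirst p

  mutual
    data RightWinsSecond (p : Pos G) : Set where
      rws : (∀ q → LeftMove G p q → RightWinsFirst q) → RightWinsSecond p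

    data RightWinsFirst (p : Pos G) : Set where
      rwf : ∀ q → RightMove G p q → RightWinsSecond q → RightWinsFirst p

  SecondPlayerWin : Pos G → Set
  SecondPlayerWin p = LeftWinsSecond p × RightWinsSecond p

open Outcomes public

Domino : Set
Domino = ℕ × ℕ

-- positions d₁ , … , d_k as a list with head d₁
DSPos : Set
DSPos = List Domino

DSLeft : DSPos → DSPos → Set
DSLeft ds ds' = ∃[ pre ] ∃[ l ] ∃[ r ] ∃[ post ]
  (ds ≡ pre ++ ((l , r) ∷ post)) × (ds' ≡ pre) × (l ≤ r) ×
  All (λ { (lj , rj) → l ≤ lj × l ≤ rj }) ((l , r) ∷ post)

DSRight : DSPos → DSPos → Set
DSRight ds ds' = ∃[ pre ] ∃[ l ] ∃[ r ] ∃[ post ]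
  (ds ≡ pre ++ ((l , r) ∷ post)) × (ds' ≡ pre) × (r ≤ l) ×
  All (λ { (lj , rj) → r ≤ lj × r ≤ rj }) ((l , r) ∷ post)

DominoShave : GameForm
DominoShave = record { Pos = DSPos ; LeftMove = DSLeft ; RightMove = DSRight }

data Colour : Set where
  blue red green : Colour

-- A finite plane rooted tree; the root is the ground vertex.  A vertex is
-- the left-to-right list of its child edges, each with its colour and the
-- subtree hanging from it.
data Tree : Set where
  node : List (Colour × Tree) → Tree

-- The trunk follows the rightmost edges.
data TrunkCut (P : Colour → Set) : Tree → Tree → Set where
  here  : ∀ {es c t} → P c →
          TrunkCut P (node (es ++ [ (c , t) ])) (node es)
  there : ∀ {es c t t'} → TrunkCut P t t' →
          TrunkCut P (node (es ++ [ (c , t) ])) (node (es ++ [ (c , t') ]))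

LeftColour : Colour → Set
LeftColour c = (c ≡ blue) ⊎ (c ≡ green)

RightColour : Colour → Set
RightColour c = (c ≡ red) ⊎ (c ≡ green)

ClockwiseHackenbush : GameForm
ClockwiseHackenbush = record
  { Pos = Tree
  ; LeftMove  = TrunkCut LeftColour
  ; RightMove = TrunkCut RightColour
  }

{-# OPTIONS --safe #-}

-- Read a tree in preorder: each edge, then the edges above it, then its right siblings.  A trunk
-- cut then deletes a final segment, as a shave does.  Let an edge of colour c carrying a subtree t,
-- followed by siblings L, correspond to a domino d of colour c (blue l < r, red l > r, green l = r),
-- followed by dominoes Q for t whose lows min (l , r) are all at least that of d, and then dominoes
-- R for L starting strictly below d.  Then the shaves allowed in the domino sequence are exactly
-- the trunk cuts of the corresponding edges, so the difference is a second-player win by copying.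
-- A pad, a blue leaf and a red leaf at the left end of a vertex, changes nothing: a cut of its red
-- leaf is answered by cutting its blue one.  As the game ignores the actual numbers on the
-- dominoes, the bijection stores them, through a pairing function, in the numbers of pads.
module Submission where

open import Defs
open import Data.Nat using (ℕ; zero; suc; _+_; _∸_; _≤_; _<_; _⊓_; z≤n; s≤s; _≤?_)
open import Data.Nat.Properties
open import Data.Nat.Induction using (<-wellFounded)
open import Induction.WellFounded using (Acc; acc)
open import Data.Product using (Σ; Σ-syntax; _×_; _,_; proj₁; proj₂)
open import Data.Sum using (_⊎_; inj₁; inj₂)
open import Data.List using (List; []; _∷_; _++_; [_]; length)
open import Data.List.Properties using (++-identityʳ; ∷-injective; length-++-≤ˡ; length-++-≤ʳ)
open import Data.List.Relation.Unary.All as All using (All; []; _∷_)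
import Data.List.Relation.Unary.All.Properties as All
open import Data.Empty using (⊥-elim)
open import Data.Unit using (⊤; tt)
open import Relation.Nullary using (¬_; yes; no)
open import Relation.Binary using (tri<; tri≈; tri>)
open import Relation.Binary.PropositionalEquality
  using (_≡_; refl; sym; trans; cong; cong₂; subst; module ≡-Reasoning)
open import Function.Bundles using (_⤖_; Bijection; mk↔ₛ′)
open import Function.Properties.Inverse using (↔⇒⤖)

data Player : Set where
  left right : Player

opponent : Player → Player
opponent left = right
opponent right = left

CutColour : Player → Colour → Set
CutColour left = LeftColour
CutColour right = RightColour

opponent-cuts-blue : ∀ p → CutColour p red → CutColour (opponent p) blue
opponent-cuts-blue left (inj₁ ())
opponent-cuts-blue left (inj₂ ())
opponent-cuts-blue right _ = inj₁ refl

pivot : Player → Domino → ℕ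
pivot left (l , r) = l
pivot right (l , r) = r

Shaveable : Player → Domino → Set
Shaveable left (l , r) = l ≤ r
Shaveable right (l , r) = r ≤ l

PivotBelow : Player → Domino → Domino → Set
PivotBelow p d (l , r) = pivot p d ≤ l × pivot p d ≤ r

low : Domino → ℕ
low (l , r) = l ⊓ r

low≤pivot : ∀ p d → low d ≤ pivot p d
low≤pivot left (l , r) = m⊓n≤m l r
low≤pivot right (l , r) = m⊓n≤n l r

pivot≡low : ∀ p d → Shaveable p d → pivot p d ≡ low d
pivot≡low left (l , r) l≤r = sym (m≤n⇒m⊓n≡m l≤r)
pivot≡low right (l , r) r≤l = sym (m≥n⇒m⊓n≡n r≤l)

pivotBelow⇒≤low : ∀ {p d y} → PivotBelow p d y → pivot p d ≤ low y
pivotBelow⇒≤low (≤l , ≤r) = ⊓-glb ≤l ≤r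

≤low⇒pivotBelow : ∀ {p d y} → pivot p d ≤ low y → PivotBelow p d y
≤low⇒pivotBelow {y = l , r} h = ≤-trans h (m⊓n≤m l r) , ≤-trans h (m⊓n≤n l r)

pivotBelow-refl : ∀ p d → Shaveable p d → PivotBelow p d d
pivotBelow-refl left (l , r) l≤r = ≤-refl , l≤r
pivotBelow-refl right (l , r) r≤l = r≤l , ≤-refl

lower⇒¬pivotBelow : ∀ {p d y} → low y < low d → ¬ PivotBelow p d y
lower⇒¬pivotBelow {p} {d} y<d below = <⇒≱ y<d (≤-trans (low≤pivot p d) (pivotBelow⇒≤low {p} {d} below))

data Shave (p : Player) : DSPos → DSPos → Set where
  shave-here  : ∀ {d ds} → Shaveable p d → All (PivotBelow p d) (d ∷ ds) → Shave p (d ∷ ds) []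
  shave-there : ∀ {d ds ds′} → Shave p ds ds′ → Shave p (d ∷ ds) (d ∷ ds′)

DSMove : Player → DSPos → DSPos → Set
DSMove left = DSLeft
DSMove right = DSRight

shave-at : ∀ {p} pre {d post} → Shaveable p d → All (PivotBelow p d) (d ∷ post) →
           Shave p (pre ++ d ∷ post) pre
shave-at [] s b = shave-here s b
shave-at (_ ∷ pre) s b = shave-there (shave-at pre s b)

DSMove⇒Shave : ∀ p {D D′} → DSMove p D D′ → Shave p D D′
DSMove⇒Shave left (pre , _ , _ , _ , refl , refl , s , b) = shave-at pre s b
DSMove⇒Shave right (pre , _ , _ , _ , refl , refl , s , b) = shave-at pre s b

Shave⇒DSLeft : ∀ {D D′} → Shave left D D′ → DSLeft D D′
Shave⇒DSLeft (shave-here s b) = [] , _ , _ , _ , refl , refl , s , b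
Shave⇒DSLeft (shave-there {d} m) with Shave⇒DSLeft m
... | pre , l , r , post , refl , refl , s , b = d ∷ pre , l , r , post , refl , refl , s , b

Shave⇒DSRight : ∀ {D D′} → Shave right D D′ → DSRight D D′
Shave⇒DSRight (shave-here s b) = [] , _ , _ , _ , refl , refl , s , b
Shave⇒DSRight (shave-there {d} m) with Shave⇒DSRight m
... | pre , l , r , post , refl , refl , s , b = d ∷ pre , l , r , post , refl , refl , s , b

All-shave : ∀ {p D D′} {P : Domino → Set} → Shave p D D′ → All P D → All P D′
All-shave (shave-here _ _) _ = []
All-shave (shave-there m) (pd ∷ pds) = pd ∷ All-shave m pds

shave-++ˡ : ∀ {p R R′} Q → Shave p R R′ → Shave p (Q ++ R) (Q ++ R′)
shave-++ˡ [] m = m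
shave-++ˡ (_ ∷ Q) m = shave-there (shave-++ˡ Q m)

shave-++[] : ∀ {p Q Q′} → Shave p Q Q′ → Shave p (Q ++ []) (Q′ ++ [])
shave-++[] {Q = Q} {Q′} m rewrite ++-identityʳ Q | ++-identityʳ Q′ = m

shave-length : ∀ {p D D′} → Shave p D D′ → length D′ < length D
shave-length (shave-here _ _) = s≤s z≤n
shave-length (shave-there m) = s≤s (shave-length m)

Above : ℕ → DSPos → Set
Above k = All (λ d → k ≤ low d)

StartsBelow : ℕ → DSPos → Set
StartsBelow k [] = ⊤
StartsBelow k (d ∷ _) = low d < k

StartsBelow-shave : ∀ {p k R R′} → Shave p R R′ → StartsBelow k R → StartsBelow k R′
StartsBelow-shave (shave-here _ _) _ = tt
StartsBelow-shave (shave-there _) below = below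

-- The head of R, lower than all of Q, blocks every shave starting in Q.
shave-split : ∀ {p k} Q {R X} → Above k Q → StartsBelow k R → Shave p (Q ++ R) X →
              (Σ[ R′ ∈ DSPos ] X ≡ Q ++ R′ × Shave p R R′)
              ⊎ (R ≡ [] × Σ[ Q′ ∈ DSPos ] X ≡ Q′ ++ [] × Shave p Q Q′)
shave-split [] _ _ m = inj₁ (_ , refl , m)
shave-split (q ∷ Q) {[]} _ _ (shave-here s b) =
  inj₂ (refl , [] , refl , shave-here s (All.head b ∷ All.++⁻ˡ Q (All.tail b)))
shave-split {p} (q ∷ Q) {h ∷ R} (k≤q ∷ _) h<k (shave-here s b) =
  ⊥-elim (lower⇒¬pivotBelow {p} {q} (<-≤-trans h<k k≤q) (All.head (All.++⁻ʳ Q (All.tail b))))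
shave-split (q ∷ Q) (_ ∷ above) below (shave-there m) with shave-split Q above below m
... | inj₁ (R′ , refl , m′) = inj₁ (R′ , refl , m′)
... | inj₂ (refl , Q′ , refl , m′) = inj₂ (refl , q ∷ Q′ , refl , shave-there m′)

Edges : Set
Edges = List (Colour × Tree)

data Cut (p : Player) : Edges → Edges → Set where
  cut-trunk : ∀ {c t} → CutColour p c → Cut p [ (c , t) ] []
  cut-above : ∀ {c M M′} → Cut p M M′ → Cut p [ (c , node M) ] [ (c , node M′) ]
  cut-right : ∀ {e e′ L L′} → Cut p (e′ ∷ L) L′ → Cut p (e ∷ e′ ∷ L) (e ∷ L′)

cut-∷ : ∀ {p e L L′} → Cut p L L′ → Cut p (e ∷ L) (e ∷ L′)
cut-∷ c@(cut-trunk _) = cut-right c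
cut-∷ c@(cut-above _) = cut-right c
cut-∷ c@(cut-right _) = cut-right c

cut-++ˡ : ∀ {p L L′} es → Cut p L L′ → Cut p (es ++ L) (es ++ L′)
cut-++ˡ [] c = c
cut-++ˡ (_ ∷ es) c = cut-∷ (cut-++ˡ es c)

TrunkCut⇒Cut : ∀ {p L L′} → TrunkCut (CutColour p) (node L) (node L′) → Cut p L L′
TrunkCut⇒Cut {p} (here {es} x) = subst (Cut p _) (++-identityʳ es) (cut-++ˡ es (cut-trunk x))
TrunkCut⇒Cut (there {es} {t = node _} {t' = node _} c) = cut-++ˡ es (cut-above (TrunkCut⇒Cut c))

trunkCut-∷ : ∀ {P e L L′} → TrunkCut P (node L) (node L′) →
             TrunkCut P (node (e ∷ L)) (node (e ∷ L′))
trunkCut-∷ {e = e} (here {es} x) = here {es = e ∷ es} x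
trunkCut-∷ {e = e} (there {es} c) = there {es = e ∷ es} c

Cut⇒TrunkCut : ∀ {p L L′} → Cut p L L′ → TrunkCut (CutColour p) (node L) (node L′)
Cut⇒TrunkCut (cut-trunk x) = here {es = []} x
Cut⇒TrunkCut (cut-above c) = there {es = []} (Cut⇒TrunkCut c)
Cut⇒TrunkCut (cut-right c) = trunkCut-∷ (Cut⇒TrunkCut c)

size : Edges → ℕ
size [] = 0
size ((_ , node M) ∷ L) = suc (size M + size L)

cut-size : ∀ {p L L′} → Cut p L L′ → size L′ < size L
cut-size (cut-trunk {t = node _} _) = s≤s z≤n
cut-size (cut-above c) = s≤s (+-monoˡ-< 0 (cut-size c))
cut-size (cut-right {e = _ , node M} c) = s≤s (+-monoʳ-< (size M) (cut-size c))

data Coloured : Colour → Domino → Set where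
  blue< : ∀ {l r} → l < r → Coloured blue (l , r)
  red> : ∀ {l r} → r < l → Coloured red (l , r)
  green≡ : ∀ {l} → Coloured green (l , l)

coloured⇒shaveable : ∀ {p c d} → Coloured c d → CutColour p c → Shaveable p d
coloured⇒shaveable {left} (blue< l<r) _ = <⇒≤ l<r
coloured⇒shaveable {left} (red> _) (inj₁ ())
coloured⇒shaveable {left} (red> _) (inj₂ ())
coloured⇒shaveable {left} green≡ _ = ≤-refl
coloured⇒shaveable {right} (blue< _) (inj₁ ())
coloured⇒shaveable {right} (blue< _) (inj₂ ())
coloured⇒shaveable {right} (red> r<l) _ = <⇒≤ r<l
coloured⇒shaveable {right} green≡ _ = ≤-refl

coloured⇒cutColour : ∀ {p c d} → Coloured c d → Shaveable p d → CutColour p c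
coloured⇒cutColour {left} (blue< _) _ = inj₁ refl
coloured⇒cutColour {left} (red> r<l) l≤r = ⊥-elim (<⇒≱ r<l l≤r)
coloured⇒cutColour {left} green≡ _ = inj₂ refl
coloured⇒cutColour {right} (blue< l<r) r≤l = ⊥-elim (<⇒≱ l<r r≤l)
coloured⇒cutColour {right} (red> _) _ = inj₁ refl
coloured⇒cutColour {right} green≡ _ = inj₂ refl

pad : Edges
pad = (blue , node []) ∷ (red , node []) ∷ []

mutual
  data Matches⁺ : DSPos → Edges → Set where
    exact  : ∀ {D L} → Matches D L → Matches⁺ D L
    padded : ∀ {D L} → Matches⁺ D L → Matches⁺ D (pad ++ L)

  data Matches : DSPos → Edges → Set where
    nil  : Matches [] []
    edge : ∀ {d Q R c M L} → Coloured c d → Above (low d) Q → StartsBelow (low d) R →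
           Matches⁺ Q M → Matches R L → Matches (d ∷ Q ++ R) ((c , node M) ∷ L)

Matches-[] : ∀ {L} → Matches [] L → L ≡ []
Matches-[] nil = refl

mutual
  matchShave⁺ : ∀ {p D D′ L} → Matches⁺ D L → Shave p D D′ →
                Σ[ L′ ∈ Edges ] Cut p L L′ × Matches⁺ D′ L′
  matchShave⁺ (exact m) s with matchShave m s
  ... | L′ , c , m′ = L′ , c , exact m′
  matchShave⁺ (padded m) s with matchShave⁺ m s
  ... | L′ , c , m′ = pad ++ L′ , cut-∷ (cut-∷ c) , padded m′

  matchShave : ∀ {p D D′ L} → Matches D L → Shave p D D′ →
               Σ[ L′ ∈ Edges ] Cut p L L′ × Matches D′ L′
  matchShave (edge {R = []} col _ _ _ mR) (shave-here s _) with refl ← Matches-[] mR =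
    [] , cut-trunk (coloured⇒cutColour col s) , nil
  matchShave {p} (edge {d} {Q} {h ∷ _} _ _ h<d _ _) (shave-here _ b) =
    ⊥-elim (lower⇒¬pivotBelow {p} {d} h<d (All.head (All.++⁻ʳ Q (All.tail b))))
  matchShave (edge {Q = Q} col above below mQ mR) (shave-there s) with shave-split Q above below s
  ... | inj₁ (_ , refl , sR) with matchShave mR sR
  ...   | _ , c , mR′ = _ , cut-∷ c , edge col above (StartsBelow-shave sR below) mQ mR′
  matchShave (edge {c = c} col above below mQ mR) (shave-there s)
      | inj₂ (refl , _ , refl , sQ) with refl ← Matches-[] mR with matchShave⁺ mQ sQ
  ...   | M′ , cM , mQ′ = [ (c , node M′) ] , cut-above cM , edge col (All-shave sQ above) tt mQ′ nil

-- A cut with p's colours is answered by a shave of p or, if it took the red leaf of a pad,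
-- by cutting the pad's blue leaf with the opponent's colours.
Reply : Player → (DSPos → Edges → Set) → DSPos → Edges → Set
Reply p Rel D L′ = (Σ[ D′ ∈ DSPos ] Shave p D D′ × Rel D′ L′)
                 ⊎ (Σ[ L′′ ∈ Edges ] Cut (opponent p) L′ L′′ × Rel D L′′)

mutual
  matchCut⁺ : ∀ {p D L L′} → Matches⁺ D L → Cut p L L′ → Reply p Matches⁺ D L′
  matchCut⁺ (exact m) c with matchCut m c
  ... | inj₁ (D′ , s , m′) = inj₁ (D′ , s , exact m′)
  ... | inj₂ (L′′ , c′ , m′) = inj₂ (L′′ , c′ , exact m′)
  matchCut⁺ {p} (padded {L = []} m) (cut-right (cut-trunk x)) = inj₂ (_ , cut-trunk (opponent-cuts-blue p x) , m)
  matchCut⁺ (padded {L = _ ∷ _} m) (cut-right (cut-right c)) with matchCut⁺ m c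
  ... | inj₁ (D′ , s , m′) = inj₁ (D′ , s , padded m′)
  ... | inj₂ (L′′ , c′ , m′) = inj₂ (pad ++ L′′ , cut-∷ (cut-∷ c′) , padded m′)

  matchCut : ∀ {p D L L′} → Matches D L → Cut p L L′ → Reply p Matches D L′
  matchCut {p} (edge {d} col above _ _ nil) (cut-trunk x) =
    inj₁ ([] , shave-here s (pivotBelow-refl p d s ∷ All.++⁺ (All.map pivotBelow above) []) , nil)
    where
    s = coloured⇒shaveable col x
    pivotBelow : ∀ {y} → low d ≤ low y → PivotBelow p d y
    pivotBelow d≤y = ≤low⇒pivotBelow {p} {d} (subst (_≤ _) (sym (pivot≡low p d s)) d≤y)
  matchCut (edge col above below mQ nil) (cut-above c) with matchCut⁺ mQ c
  ... | inj₁ (_ , s , mQ′) = inj₁ (_ , shave-there (shave-++[] s) , edge col (All-shave s above) tt mQ′ nil)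
  ... | inj₂ (_ , c′ , mQ′) = inj₂ (_ , cut-above c′ , edge col above below mQ′ nil)
  matchCut (edge {Q = Q} col above below mQ mR) (cut-right c) with matchCut mR c
  ... | inj₁ (_ , s , mR′) =
    inj₁ (_ , shave-there (shave-++ˡ Q s) , edge col above (StartsBelow-shave s below) mQ mR′)
  ... | inj₂ (_ , c′ , mR′) = inj₂ (_ , cut-∷ c′ , edge col above below mQ mR′)

ShaveMinusHackenbush : GameForm
ShaveMinusHackenbush = DominoShave ⊖ ClockwiseHackenbush

weight : DSPos → Edges → ℕ
weight D L = length D + size L

weight-shave-cut : ∀ {p q D D′ L L′} → Shave p D D′ → Cut q L L′ → weight D′ L′ < weight D L
weight-shave-cut s c = +-mono-< (shave-length s) (cut-size c)

weight-cut-cut : ∀ {p q D L L′ L′′} → Cut q L′ L′′ → Cut p L L′ → weight D L′′ < weight D L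
weight-cut-cut {D = D} c′ c = +-monoʳ-< (length D) (<-trans (cut-size c′) (cut-size c))

-- Moving second, each player copies the opponent's move into the other component; in the negated
-- tree component a cut with Right's colours is a move of Left, and vice versa.
leftWins : ∀ {D L} → Acc _<_ (weight D L) → Matches⁺ D L →
           LeftWinsSecond ShaveMinusHackenbush (D , node L)
leftWins {D} {L} (acc smaller) m = lws λ where
    (_ , _) (inj₁ (move , refl)) → afterShave (DSMove⇒Shave right move)
    (_ , node _) (inj₂ (refl , move)) → afterCut (TrunkCut⇒Cut move) (matchCut⁺ m (TrunkCut⇒Cut move))
  where
  afterShave : ∀ {D′} → Shave right D D′ → LeftWinsFirst ShaveMinusHackenbush (D′ , node L)
  afterShave s with matchShave⁺ m s
  ... | L′ , c , m′ =
    lwf (_ , node L′) (inj₂ (refl , Cut⇒TrunkCut c)) (leftWins (smaller (weight-shave-cut s c)) m′)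

  afterCut : ∀ {L′} → Cut left L L′ → Reply left Matches⁺ D L′ →
             LeftWinsFirst ShaveMinusHackenbush (D , node L′)
  afterCut c (inj₁ (_ , s , m′)) =
    lwf (_ , node _) (inj₁ (Shave⇒DSLeft s , refl)) (leftWins (smaller (weight-shave-cut s c)) m′)
  afterCut c (inj₂ (_ , c′ , m′)) =
    lwf (D , node _) (inj₂ (refl , Cut⇒TrunkCut c′)) (leftWins (smaller (weight-cut-cut {D = D} c′ c)) m′)

rightWins : ∀ {D L} → Acc _<_ (weight D L) → Matches⁺ D L →
            RightWinsSecond ShaveMinusHackenbush (D , node L)
rightWins {D} {L} (acc smaller) m = rws λ where
    (_ , _) (inj₁ (move , refl)) → afterShave (DSMove⇒Shave left move)
    (_ , node _) (inj₂ (refl , move)) → afterCut (TrunkCut⇒Cut move) (matchCut⁺ m (TrunkCut⇒Cut move))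
  where
  afterShave : ∀ {D′} → Shave left D D′ → RightWinsFirst ShaveMinusHackenbush (D′ , node L)
  afterShave s with matchShave⁺ m s
  ... | L′ , c , m′ =
    rwf (_ , node L′) (inj₂ (refl , Cut⇒TrunkCut c)) (rightWins (smaller (weight-shave-cut s c)) m′)

  afterCut : ∀ {L′} → Cut right L L′ → Reply right Matches⁺ D L′ →
             RightWinsFirst ShaveMinusHackenbush (D , node L′)
  afterCut c (inj₁ (_ , s , m′)) =
    rwf (_ , node _) (inj₁ (Shave⇒DSRight s , refl)) (rightWins (smaller (weight-shave-cut s c)) m′)
  afterCut c (inj₂ (_ , c′ , m′)) =
    rwf (D , node _) (inj₂ (refl , Cut⇒TrunkCut c′)) (rightWins (smaller (weight-cut-cut {D = D} c′ c)) m′)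

matches⇒secondPlayerWin : ∀ {D L} → Matches⁺ D L → SecondPlayerWin ShaveMinusHackenbush (D , node L)
matches⇒secondPlayerWin m = leftWins (<-wellFounded _) m , rightWins (<-wellFounded _) m

-- The enumeration (0,0), (0,1), (1,0), (0,2), (1,1), (2,0), … of ℕ × ℕ along antidiagonals.
next : ℕ × ℕ → ℕ × ℕ
next (n , suc k) = suc n , k
next (n , zero) = zero , suc n

unpair : ℕ → ℕ × ℕ
unpair zero = 0 , 0
unpair (suc K) = next (unpair K)

triangle : ℕ → ℕ
triangle zero = zero
triangle (suc s) = suc s + triangle s

pair : ℕ × ℕ → ℕ
pair (n , k) = triangle (n + k) + n

pair-next : ∀ p → pair (next p) ≡ suc (pair p)
pair-next (n , suc k) = begin
  triangle (suc (n + k)) + suc n    ≡⟨ +-suc _ n ⟩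
  suc (triangle (suc (n + k)) + n)  ≡⟨ cong (λ s → suc (triangle s + n)) (sym (+-suc n k)) ⟩
  suc (triangle (n + suc k) + n)    ∎
  where open ≡-Reasoning
pair-next (n , zero) = begin
  suc n + triangle n + 0          ≡⟨ +-identityʳ _ ⟩
  suc (n + triangle n)            ≡⟨ cong suc (+-comm n (triangle n)) ⟩
  suc (triangle n + n)            ≡⟨ cong (λ s → suc (triangle s + n)) (sym (+-identityʳ n)) ⟩
  suc (triangle (n + 0) + n)      ∎
  where open ≡-Reasoning

pair-unpair : ∀ K → pair (unpair K) ≡ K
pair-unpair zero = refl
pair-unpair (suc K) = trans (pair-next (unpair K)) (cong suc (pair-unpair K))

unpair-injective : ∀ {K₁ K₂} → unpair K₁ ≡ unpair K₂ → K₁ ≡ K₂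
unpair-injective {K₁} {K₂} e = trans (sym (pair-unpair K₁)) (trans (cong pair e) (pair-unpair K₂))

unpair-pair : ∀ p → unpair (pair p) ≡ p
unpair-pair p = go (pair p) p refl
  where
  go : ∀ K p → pair p ≡ K → unpair K ≡ p
  go zero (zero , zero) _ = refl
  go (suc K) (suc n , k) e = cong next (go K (n , suc k) (suc-injective (trans (sym (pair-next (n , suc k))) e)))
  go (suc K) (zero , suc k) e = cong next (go K (k , zero) (suc-injective (trans (sym (pair-next (k , zero))) e)))

proj₂-unpair-≤ : ∀ K → proj₂ (unpair K) ≤ K
proj₂-unpair-≤ K = subst (proj₂ (unpair K) ≤_) (pair-unpair K) (k≤pair (unpair K))
  where
  s≤triangle : ∀ s → s ≤ triangle s
  s≤triangle zero = z≤n
  s≤triangle (suc s) = m≤m+n (suc s) (triangle s)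
  k≤pair : ∀ p → proj₂ p ≤ pair p
  k≤pair (n , k) = ≤-trans (m≤n+m k n) (≤-trans (s≤triangle (n + k)) (m≤m+n _ n))

domino : Colour → ℕ → ℕ → Domino
domino blue μ g = μ , suc (μ + g)
domino red μ g = suc (μ + g) , μ
domino green μ _ = μ , μ

low-domino : ∀ c μ g → low (domino c μ g) ≡ μ
low-domino blue μ g = m≤n⇒m⊓n≡m (m≤n⇒m≤1+n (m≤m+n μ g))
low-domino red μ g = m≥n⇒m⊓n≡n (m≤n⇒m≤1+n (m≤m+n μ g))
low-domino green μ _ = ⊓-idem μ

coloured-domino : ∀ c μ g → Coloured c (domino c μ g)
coloured-domino blue μ g = blue< (s≤s (m≤m+n μ g))
coloured-domino red μ g = red> (s≤s (m≤m+n μ g))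
coloured-domino green μ _ = green≡

Coloured-functional : ∀ {c₁ c₂ d} → Coloured c₁ d → Coloured c₂ d → c₁ ≡ c₂
Coloured-functional (blue< _) (blue< _) = refl
Coloured-functional (blue< l<r) (red> r<l) = ⊥-elim (<-asym l<r r<l)
Coloured-functional (blue< l<l) green≡ = ⊥-elim (<-irrefl refl l<l)
Coloured-functional (red> r<l) (blue< l<r) = ⊥-elim (<-asym l<r r<l)
Coloured-functional (red> _) (red> _) = refl
Coloured-functional (red> l<l) green≡ = ⊥-elim (<-irrefl refl l<l)
Coloured-functional green≡ (blue< l<l) = ⊥-elim (<-irrefl refl l<l)
Coloured-functional green≡ (red> l<l) = ⊥-elim (<-irrefl refl l<l)
Coloured-functional green≡ green≡ = refl

domino-view : ∀ l r → Σ[ c ∈ Colour ] Σ[ g ∈ ℕ ] (c ≡ green → g ≡ 0) × domino c (l ⊓ r) g ≡ (l , r)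
domino-view l r with <-cmp l r
... | tri< l<r _ _ =
  blue , r ∸ suc l , (λ ()) ,
  cong₂ _,_ l⊓r≡l (trans (cong (λ μ → suc (μ + (r ∸ suc l))) l⊓r≡l) (m+[n∸m]≡n l<r))
  where l⊓r≡l = m≤n⇒m⊓n≡m (<⇒≤ l<r)
... | tri≈ _ refl _ = green , 0 , (λ _ → refl) , cong₂ _,_ (⊓-idem l) (⊓-idem l)
... | tri> _ _ r<l =
  red , l ∸ suc r , (λ ()) ,
  cong₂ _,_ (trans (cong (λ μ → suc (μ + (l ∸ suc r))) l⊓r≡r) (m+[n∸m]≡n r<l)) l⊓r≡r
  where l⊓r≡r = m≥n⇒m⊓n≡n (<⇒≤ r<l)

-- A label codes the offset of a domino's low above its floor and, unless it is green, its gap.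
decodeLabel : Colour → ℕ → ℕ × ℕ
decodeLabel green n = n , 0
decodeLabel blue n = unpair n
decodeLabel red n = unpair n

encodeLabel : Colour → ℕ × ℕ → ℕ
encodeLabel green (a , _) = a
encodeLabel blue ag = pair ag
encodeLabel red ag = pair ag

decode-encode : ∀ c a g → (c ≡ green → g ≡ 0) → decodeLabel c (encodeLabel c (a , g)) ≡ (a , g)
decode-encode green a g g≡0 = cong (a ,_) (sym (g≡0 refl))
decode-encode blue a g _ = unpair-pair (a , g)
decode-encode red a g _ = unpair-pair (a , g)

labelledDomino : ℕ → Colour → ℕ → Domino
labelledDomino f c n = domino c (f + proj₁ (decodeLabel c n)) (proj₂ (decodeLabel c n))

labelledDomino-injective : ∀ f {c₁ c₂ n₁ n₂} → labelledDomino f c₁ n₁ ≡ labelledDomino f c₂ n₂ →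
                           c₁ ≡ c₂ × n₁ ≡ n₂
labelledDomino-injective f {c₁} {c₂} {n₁} {n₂} e
  with refl ← Coloured-functional (coloured-domino c₁ _ _) (subst (Coloured c₂) (sym e) (coloured-domino c₂ _ _))
  = refl , same-colour c₁ e
  where
  offsets : ∀ {a₁ a₂} → f + a₁ ≡ f + a₂ → a₁ ≡ a₂
  offsets = +-cancelˡ-≡ f _ _
  gaps : ∀ {μ₁ μ₂ g₁ g₂} → μ₁ ≡ μ₂ → suc (μ₁ + g₁) ≡ suc (μ₂ + g₂) → g₁ ≡ g₂
  gaps {μ₁} refl e′ = +-cancelˡ-≡ μ₁ _ _ (suc-injective e′)
  same-colour : ∀ c → labelledDomino f c n₁ ≡ labelledDomino f c n₂ → n₁ ≡ n₂
  same-colour green e′ = offsets (cong proj₁ e′)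
  same-colour blue e′ =
    unpair-injective (cong₂ _,_ (offsets (cong proj₁ e′)) (gaps (cong proj₁ e′) (cong proj₂ e′)))
  same-colour red e′ =
    unpair-injective (cong₂ _,_ (offsets (cong proj₂ e′)) (gaps (cong proj₂ e′) (cong proj₁ e′)))

floor : ℕ → DSPos → ℕ
floor b [] = b
floor b (d ∷ _) = suc (low d)

edgeLow : ℕ → Colour → ℕ → DSPos → ℕ
edgeLow b c n R = floor b R + proj₁ (decodeLabel c n)

consEdge : ℕ → Colour → ℕ → (ℕ → DSPos) → DSPos → DSPos
consEdge b c n above R = labelledDomino (floor b R) c n ∷ above (edgeLow b c n R) ++ R

consPad : ℕ → DSPos → DSPos
consPad b X = consEdge b blue 0 (λ _ → []) (consEdge b red 0 (λ _ → []) X)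

consPads : ℕ → ℕ → DSPos → DSPos
consPads b zero X = X
consPads b (suc k) X = consPad b (consPads b k X)

edgeLabel : ℕ → Edges → ℕ
edgeLabel k ((blue , node []) ∷ (red , node []) ∷ M) = edgeLabel (suc k) M
edgeLabel k M = proj₁ (unpair k)

-- toDominoes b L reads the edges L in preorder, keeping all lows at least b; the floor of an
-- edge's domino is b, or one above the low of the first domino of its right siblings.  The K leading
-- pads under an edge are not read literally: unpair K = (n , k) gives the label n of the edge's
-- domino and the number k of pads read as dominoes above it.
mutual
  toDominoes : ℕ → Edges → DSPos
  toDominoes b [] = []
  toDominoes b ((c , node M) ∷ L) = consEdge b c (edgeLabel 0 M) (λ μ → dominoesAbove μ 0 M) (toDominoes b L)

  dominoesAbove : ℕ → ℕ → Edges → DSPos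
  dominoesAbove μ k ((blue , node []) ∷ (red , node []) ∷ M) = dominoesAbove μ (suc k) M
  dominoesAbove μ k M = consPads μ (proj₂ (unpair k)) (toDominoes μ M)

pads : ℕ → Edges
pads zero = []
pads (suc k) = pad ++ pads k

toDominoes-pads : ∀ b k X → toDominoes b (pads k ++ X) ≡ consPads b k (toDominoes b X)
toDominoes-pads b zero X = refl
toDominoes-pads b (suc k) X = cong (consPad b) (toDominoes-pads b k X)

pads-suc : ∀ k X → pads k ++ pad ++ X ≡ pads (suc k) ++ X
pads-suc zero X = refl
pads-suc (suc k) X = cong (pad ++_) (pads-suc k X)

data StartsWithPad : Edges → Set where
  pad++ : ∀ M → StartsWithPad (pad ++ M)

record Unpadded (M : Edges) : Set where
  constructor unpadded
  field
    ¬pad : ¬ StartsWithPad M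
    edgeLabel-unpadded : ∀ k → edgeLabel k M ≡ proj₁ (unpair k)
    dominoesAbove-unpadded : ∀ μ k → dominoesAbove μ k M ≡ consPads μ (proj₂ (unpair k)) (toDominoes μ M)

open Unpadded

padView : ∀ M → StartsWithPad M ⊎ Unpadded M
padView ((blue , node []) ∷ (red , node []) ∷ M) = inj₁ (pad++ M)
padView [] = inj₂ (unpadded (λ ()) (λ _ → refl) (λ _ _ → refl))
padView ((green , _) ∷ _) = inj₂ (unpadded (λ ()) (λ _ → refl) (λ _ _ → refl))
padView ((red , _) ∷ _) = inj₂ (unpadded (λ ()) (λ _ → refl) (λ _ _ → refl))
padView ((blue , node (_ ∷ _)) ∷ _) = inj₂ (unpadded (λ ()) (λ _ → refl) (λ _ _ → refl))
padView ((blue , node []) ∷ []) = inj₂ (unpadded (λ ()) (λ _ → refl) (λ _ _ → refl))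
padView ((blue , node []) ∷ (blue , _) ∷ _) = inj₂ (unpadded (λ ()) (λ _ → refl) (λ _ _ → refl))
padView ((blue , node []) ∷ (green , _) ∷ _) = inj₂ (unpadded (λ ()) (λ _ → refl) (λ _ _ → refl))
padView ((blue , node []) ∷ (red , node (_ ∷ _)) ∷ _) = inj₂ (unpadded (λ ()) (λ _ → refl) (λ _ _ → refl))

decompose : ∀ M → Σ[ K ∈ ℕ ] Σ[ M₀ ∈ Edges ] M ≡ pads K ++ M₀ × Unpadded M₀
decompose M with padView M
... | inj₁ (pad++ M₁) with decompose M₁
...   | K , M₀ , refl , u = suc K , M₀ , refl , u
decompose M | inj₂ u = 0 , M , refl , u

pads-unique : ∀ k₁ k₂ {X₁ X₂} → Unpadded X₁ → Unpadded X₂ → pads k₁ ++ X₁ ≡ pads k₂ ++ X₂ →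
              k₁ ≡ k₂ × X₁ ≡ X₂
pads-unique zero zero _ _ e = refl , e
pads-unique zero (suc k₂) u₁ _ refl = ⊥-elim (¬pad u₁ (pad++ _))
pads-unique (suc k₁) zero _ u₂ refl = ⊥-elim (¬pad u₂ (pad++ _))
pads-unique (suc k₁) (suc k₂) u₁ u₂ e
  with refl , refl ← pads-unique k₁ k₂ u₁ u₂ (proj₂ (∷-injective (proj₂ (∷-injective e)))) = refl , refl

edgeLabel-pads : ∀ K {M} → Unpadded M → edgeLabel 0 (pads K ++ M) ≡ proj₁ (unpair K)
edgeLabel-pads K {M} u = trans (go K 0) (cong (λ j → proj₁ (unpair j)) (+-identityʳ K))
  where
  go : ∀ K k → edgeLabel k (pads K ++ M) ≡ proj₁ (unpair (K + k))
  go zero k = edgeLabel-unpadded u k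
  go (suc K) k = trans (go K (suc k)) (cong (λ j → proj₁ (unpair j)) (+-suc K k))

dominoesAbove-pads : ∀ μ K {M} → Unpadded M →
                     dominoesAbove μ 0 (pads K ++ M) ≡ toDominoes μ (pads (proj₂ (unpair K)) ++ M)
dominoesAbove-pads μ K {M} u = begin
  dominoesAbove μ 0 (pads K ++ M)                       ≡⟨ go K 0 ⟩
  consPads μ (proj₂ (unpair (K + 0))) (toDominoes μ M)  ≡⟨ cong (λ j → consPads μ (proj₂ (unpair j)) _) (+-identityʳ K) ⟩
  consPads μ (proj₂ (unpair K)) (toDominoes μ M)        ≡⟨ sym (toDominoes-pads μ _ M) ⟩
  toDominoes μ (pads (proj₂ (unpair K)) ++ M)           ∎
  where
  open ≡-Reasoning
  go : ∀ K k → dominoesAbove μ k (pads K ++ M) ≡ consPads μ (proj₂ (unpair (K + k))) (toDominoes μ M)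
  go zero k = dominoesAbove-unpadded u μ k
  go (suc K) k = trans (go K (suc k)) (cong (λ j → consPads μ (proj₂ (unpair j)) (toDominoes μ M)) (+-suc K k))

floor-≥ : ∀ b R → Above b R → b ≤ floor b R
floor-≥ b [] _ = ≤-refl
floor-≥ b (_ ∷ _) (b≤d ∷ _) = m≤n⇒m≤1+n b≤d

floor-≤ : ∀ {b k} R → b ≤ k → StartsBelow k R → floor b R ≤ k
floor-≤ [] b≤k _ = b≤k
floor-≤ (_ ∷ _) _ d<k = d<k

startsBelow-floor : ∀ b a R → StartsBelow (floor b R + a) R
startsBelow-floor b a [] = tt
startsBelow-floor b a (d ∷ _) = s≤s (m≤m+n (low d) a)

low-labelledDomino : ∀ b c n R → low (labelledDomino (floor b R) c n) ≡ edgeLow b c n R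
low-labelledDomino b c n R = low-domino c _ _

consEdge-above : ∀ b c n above R → Above b R → Above (edgeLow b c n R) (above (edgeLow b c n R)) →
                 Above b (consEdge b c n above R)
consEdge-above b c n above R R↑ A↑ =
  subst (b ≤_) (sym (low-labelledDomino b c n R)) b≤μ ∷ All.++⁺ (All.map (≤-trans b≤μ) A↑) R↑
  where
  b≤μ : b ≤ edgeLow b c n R
  b≤μ = ≤-trans (floor-≥ b R R↑) (m≤m+n _ _)

consPads-above : ∀ μ k X → Above μ X → Above μ (consPads μ k X)
consPads-above μ zero X X↑ = X↑
consPads-above μ (suc k) X X↑ =
  consEdge-above μ blue 0 (λ _ → []) _ (consEdge-above μ red 0 (λ _ → []) _ (consPads-above μ k X X↑) []) []

mutual
  toDominoes-above : ∀ b L → Above b (toDominoes b L)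
  toDominoes-above b [] = []
  toDominoes-above b ((c , node M) ∷ L) =
    consEdge-above b c (edgeLabel 0 M) (λ μ → dominoesAbove μ 0 M) (toDominoes b L)
      (toDominoes-above b L) (dominoesAbove-above _ 0 M)

  dominoesAbove-above : ∀ μ k M → Above μ (dominoesAbove μ k M)
  dominoesAbove-above μ k M with padView M
  ... | inj₁ (pad++ M₀) = dominoesAbove-above μ (suc k) M₀
  ... | inj₂ u = subst (Above μ) (sym (dominoesAbove-unpadded u μ k)) (consPads-above μ _ _ (toDominoes-above μ M))

consEdge-matches : ∀ b c n above R M L → Above (edgeLow b c n R) (above (edgeLow b c n R)) →
                   Matches⁺ (above (edgeLow b c n R)) M → Matches R L →
                   Matches (consEdge b c n above R) ((c , node M) ∷ L)
consEdge-matches b c n above R M L A↑ mA mR =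
  edge (coloured-domino c _ _) (subst (λ k → Above k (above μ)) lows A↑)
       (subst (λ k → StartsBelow k R) lows (startsBelow-floor b _ R)) mA mR
  where
  μ = edgeLow b c n R
  lows : μ ≡ low (labelledDomino (floor b R) c n)
  lows = sym (low-labelledDomino b c n R)

consPads-matches : ∀ μ k {X M} → Matches X M → Matches (consPads μ k X) (pads k ++ M)
consPads-matches μ zero m = m
consPads-matches μ (suc k) m =
  consEdge-matches μ blue 0 (λ _ → []) _ [] _ [] (exact nil)
    (consEdge-matches μ red 0 (λ _ → []) _ [] _ [] (exact nil) (consPads-matches μ k m))

padded-pads : ∀ e {D k M} → Matches⁺ D (pads k ++ M) → Matches⁺ D (pads (e + k) ++ M)
padded-pads zero m = m
padded-pads (suc e) m = padded (padded-pads e m)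

mutual
  toDominoes-matches : ∀ b L → Matches (toDominoes b L) L
  toDominoes-matches b [] = nil
  toDominoes-matches b ((c , node M) ∷ L) =
    consEdge-matches b c (edgeLabel 0 M) (λ μ → dominoesAbove μ 0 M) (toDominoes b L) M L
      (dominoesAbove-above _ 0 M) (dominoesAbove-matches _ 0 M) (toDominoes-matches b L)

  -- The k pads already stripped off M reappear: unpair k keeps k′ ≤ k of them as dominoes and
  -- the other k ∸ k′ are unmatched padding.
  dominoesAbove-matches : ∀ μ k M → Matches⁺ (dominoesAbove μ k M) (pads k ++ M)
  dominoesAbove-matches μ k M with padView M
  ... | inj₁ (pad++ M₀) = subst (Matches⁺ _) (sym (pads-suc k M₀)) (dominoesAbove-matches μ (suc k) M₀)
  ... | inj₂ u = subst (λ D → Matches⁺ D (pads k ++ M)) (sym (dominoesAbove-unpadded u μ k))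
                   (subst (λ j → Matches⁺ kept (pads j ++ M)) (m∸n+n≡m (proj₂-unpair-≤ k))
                     (padded-pads (k ∸ k′) (exact (consPads-matches μ k′ (toDominoes-matches μ M)))))
    where
    k′ = proj₂ (unpair k)
    kept = consPads μ k′ (toDominoes μ M)

split-at : ∀ k D → Σ[ Q ∈ DSPos ] Σ[ R ∈ DSPos ] Q ++ R ≡ D × Above k Q × StartsBelow k R
split-at k [] = [] , [] , refl , [] , tt
split-at k (d ∷ D) with k ≤? low d
... | no k≰d = [] , d ∷ D , refl , [] , ≰⇒> k≰d
... | yes k≤d with Q , R , refl , Q↑ , R↓ ← split-at k D = d ∷ Q , R , refl , k≤d ∷ Q↑ , R↓

split-unique : ∀ {k} Q₁ Q₂ {R₁ R₂} → Above k Q₁ → Above k Q₂ → StartsBelow k R₁ → StartsBelow k R₂ →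
               Q₁ ++ R₁ ≡ Q₂ ++ R₂ → Q₁ ≡ Q₂ × R₁ ≡ R₂
split-unique [] [] _ _ _ _ e = refl , e
split-unique [] (q ∷ _) _ (k≤q ∷ _) q<k _ refl = ⊥-elim (<⇒≱ q<k k≤q)
split-unique (q ∷ _) [] (k≤q ∷ _) _ _ q<k refl = ⊥-elim (<⇒≱ q<k k≤q)
split-unique (q ∷ Q₁) (_ ∷ Q₂) (_ ∷ Q₁↑) (_ ∷ Q₂↑) R₁↓ R₂↓ e
  with refl , e′ ← ∷-injective e with refl , refl ← split-unique Q₁ Q₂ Q₁↑ Q₂↑ R₁↓ R₂↓ e′ = refl , refl

consEdge-encode : ∀ b c g above R {μ} → (c ≡ green → g ≡ 0) → floor b R ≤ μ →
                  consEdge b c (encodeLabel c (μ ∸ floor b R , g)) above R ≡ domino c μ g ∷ above μ ++ R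
consEdge-encode b c g above R {μ} green⇒g≡0 f≤μ =
  cong₂ (λ μ′ g′ → domino c μ′ g′ ∷ above μ′ ++ R) low≡ (cong proj₂ decoded)
  where
  decoded = decode-encode c (μ ∸ floor b R) g green⇒g≡0
  low≡ : floor b R + proj₁ (decodeLabel c (encodeLabel c (μ ∸ floor b R , g))) ≡ μ
  low≡ = trans (cong (λ a → floor b R + proj₁ a) decoded) (m+[n∸m]≡n f≤μ)

relabel : ∀ n M → Σ[ M′ ∈ Edges ] edgeLabel 0 M′ ≡ n × (∀ μ → dominoesAbove μ 0 M′ ≡ toDominoes μ M)
relabel n M with K , M₀ , refl , u ← decompose M =
  pads (pair (n , K)) ++ M₀ ,
  trans (edgeLabel-pads (pair (n , K)) u) (cong proj₁ (unpair-pair (n , K))) ,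
  λ μ → trans (dominoesAbove-pads μ (pair (n , K)) u)
              (cong (λ p → toDominoes μ (pads (proj₂ p) ++ M₀)) (unpair-pair (n , K)))

toDominoes-surjective : ∀ {b D} → Acc _<_ (length D) → Above b D → Σ[ L ∈ Edges ] toDominoes b L ≡ D
toDominoes-surjective {D = []} _ _ = [] , refl
toDominoes-surjective {b} {(l , r) ∷ D} (acc smaller) (b≤d ∷ D↑)
  with Q , R , refl , Q↑ , R↓ ← split-at (l ⊓ r) D
  with c , g , green⇒g≡0 , domino≡ ← domino-view l r
  with L , L≡ ← toDominoes-surjective (smaller (s≤s (length-++-≤ʳ R {Q}))) (All.++⁻ʳ Q D↑)
  with LQ , LQ≡ ← toDominoes-surjective (smaller (s≤s (length-++-≤ˡ Q))) Q↑
  with M , label≡ , above≡ ← relabel (encodeLabel c (l ⊓ r ∸ floor b R , g)) LQ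
  = (c , node M) ∷ L , (begin
    consEdge b c (edgeLabel 0 M) above (toDominoes b L)
      ≡⟨ cong₂ (λ n R′ → consEdge b c n above R′) label≡ L≡ ⟩
    consEdge b c (encodeLabel c (l ⊓ r ∸ floor b R , g)) above R
      ≡⟨ consEdge-encode b c g above R green⇒g≡0 (floor-≤ R b≤d R↓) ⟩
    domino c (l ⊓ r) g ∷ above (l ⊓ r) ++ R
      ≡⟨ cong₂ (λ d Q′ → d ∷ Q′ ++ R) domino≡ (trans (above≡ (l ⊓ r)) LQ≡) ⟩
    (l , r) ∷ Q ++ R ∎)
  where
  open ≡-Reasoning
  above : ℕ → DSPos
  above μ = dominoesAbove μ 0 M

consEdge-injective : ∀ {b c₁ c₂ n₁ n₂ A₁ A₂ R₁ R₂} →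
                     (∀ μ → Above μ (A₁ μ)) → (∀ μ → Above μ (A₂ μ)) →
                     consEdge b c₁ n₁ A₁ R₁ ≡ consEdge b c₂ n₂ A₂ R₂ →
                     c₁ ≡ c₂ × n₁ ≡ n₂ × R₁ ≡ R₂ × A₁ (edgeLow b c₁ n₁ R₁) ≡ A₂ (edgeLow b c₁ n₁ R₁)
consEdge-injective {b} {c₁} {c₂} {n₁} {n₂} {A₁} {A₂} {R₁} {R₂} A₁↑ A₂↑ e
  with head≡ , tail≡ ← ∷-injective e
  with μ≡ ← trans (sym (low-labelledDomino b c₁ n₁ R₁))
                  (trans (cong low head≡) (low-labelledDomino b c₂ n₂ R₂))
  with A≡ , refl ← split-unique (A₁ (edgeLow b c₁ n₁ R₁)) (A₂ (edgeLow b c₂ n₂ R₂))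
                     (A₁↑ _) (subst (λ k → Above k (A₂ (edgeLow b c₂ n₂ R₂))) (sym μ≡) (A₂↑ _))
                     (startsBelow-floor b _ R₁)
                     (subst (λ k → StartsBelow k R₂) (sym μ≡) (startsBelow-floor b _ R₂)) tail≡
  with refl , refl ← labelledDomino-injective (floor b R₁) head≡
  = refl , refl , refl , A≡

size-pads-≤ : ∀ X {k K} → k ≤ K → size (pads k ++ X) ≤ size (pads K ++ X)
size-pads-≤ X {K = zero} z≤n = ≤-refl
size-pads-≤ X {K = suc K} z≤n = m≤n⇒m≤1+n (m≤n⇒m≤1+n (size-pads-≤ X {K = K} z≤n))
size-pads-≤ X (s≤s k≤K) = s≤s (s≤s (size-pads-≤ X k≤K))

-- The first hypothesis is the induction hypothesis of toDominoes-injective.  It is applied to the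
-- pads kept from M₁ followed by the rest of M₁: not a sublist of M₁, but no larger.
subtree-injective : ∀ {μ M₁ M₂} →
                    (∀ {X₁ X₂} → size X₁ ≤ size M₁ → toDominoes μ X₁ ≡ toDominoes μ X₂ → X₁ ≡ X₂) →
                    edgeLabel 0 M₁ ≡ edgeLabel 0 M₂ → dominoesAbove μ 0 M₁ ≡ dominoesAbove μ 0 M₂ → M₁ ≡ M₂
subtree-injective {μ} {M₁} {M₂} toDominoes-inj label≡ above≡
  with K₁ , X₁ , refl , u₁ ← decompose M₁ | K₂ , X₂ , refl , u₂ ← decompose M₂
  with kept≡ , refl ← pads-unique (proj₂ (unpair K₁)) (proj₂ (unpair K₂)) u₁ u₂
         (toDominoes-inj (size-pads-≤ X₁ (proj₂-unpair-≤ K₁))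
           (trans (sym (dominoesAbove-pads μ K₁ u₁)) (trans above≡ (dominoesAbove-pads μ K₂ u₂))))
  with refl ← unpair-injective {K₁} {K₂}
                (cong₂ _,_ (trans (sym (edgeLabel-pads K₁ u₁)) (trans label≡ (edgeLabel-pads K₂ u₂))) kept≡)
  = refl

toDominoes-injective : ∀ {b L₁ L₂} → Acc _<_ (size L₁) → toDominoes b L₁ ≡ toDominoes b L₂ → L₁ ≡ L₂
toDominoes-injective {L₁ = []} {[]} _ _ = refl
toDominoes-injective {L₁ = []} {(_ , node _) ∷ _} _ ()
toDominoes-injective {L₁ = (_ , node _) ∷ _} {[]} _ ()
toDominoes-injective {b} {(c₁ , node M₁) ∷ L₁} {(c₂ , node M₂) ∷ L₂} (acc smaller) e
  with refl , label≡ , tail≡ , above≡ ←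
         consEdge-injective (λ μ → dominoesAbove-above μ 0 M₁) (λ μ → dominoesAbove-above μ 0 M₂) e
  with refl ← toDominoes-injective (smaller (s≤s (m≤n+m _ _))) tail≡
  = cong (λ M → (c₁ , node M) ∷ L₁)
      (subtree-injective (λ X≤M → toDominoes-injective (smaller (s≤s (≤-trans X≤M (m≤m+n _ _))))) label≡ above≡)

dominoes : Tree → DSPos
dominoes (node L) = toDominoes 0 L

dominoes-injective : ∀ {t₁ t₂} → dominoes t₁ ≡ dominoes t₂ → t₁ ≡ t₂
dominoes-injective {node L₁} {node L₂} e = cong node (toDominoes-injective (<-wellFounded _) e)

dominoes-surjective : ∀ D → Σ[ t ∈ Tree ] dominoes t ≡ D
dominoes-surjective D
  with L , L≡ ← toDominoes-surjective (<-wellFounded _) (All.tabulate (λ _ → z≤n)) = node L , L≡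

tree : DSPos → Tree
tree D = proj₁ (dominoes-surjective D)

dominoes-tree : ∀ D → dominoes (tree D) ≡ D
dominoes-tree D = proj₂ (dominoes-surjective D)

tree-dominoes : ∀ t → tree (dominoes t) ≡ t
tree-dominoes t = dominoes-injective (dominoes-tree (dominoes t))

tree-bijection : DSPos ⤖ Tree
tree-bijection = ↔⇒⤖ (mk↔ₛ′ tree dominoes tree-dominoes dominoes-tree)

dominoes-secondPlayerWin : ∀ t → SecondPlayerWin ShaveMinusHackenbush (dominoes t , t)
dominoes-secondPlayerWin (node L) = matches⇒secondPlayerWin (exact (toDominoes-matches 0 L))

theorem3p5 : Σ (DSPos ⤖ Tree) (λ f → ∀ (D : DSPos) → SecondPlayerWin (DominoShave ⊖ ClockwiseHackenbush) (D , Bijection.to f D))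
theorem3p5 = tree-bijection , λ D →
  subst (λ D′ → SecondPlayerWin ShaveMinusHackenbush (D′ , tree D)) (dominoes-tree D) (dominoes-secondPlayerWin (tree D))
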